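{- Let $k\ge3$ be odd, let $H$ be a Kimura Hadamard matrix of order $n=8k+4$ and let $(R,S)\in\mathrm{Aut}(H)$ with $R=\mathrm{diag}(r_1,\dots,r_n)$ a diagonal matrix and $r_1=-1$. Then $(R,S)=(-I_n,-I_n)$.
   Context: $D_{2k}=\langle x,y\mid x^k=1,\ y^2=1,\ y^{ -1}xy=x^{ -1}\rangle$, with elements listed in the order $x^0,\dots,x^{k-1},y,xy,\dots,x^{k-1}y$, which indexes rows and columns of $2k\times2k$ matrices. $\rho(g)=[\delta_{ug,v}]_{u,v}$ is the right regular matrix representation, extended linearly to $\mathbb{Z}D_{2k}$; for $w\in\mathbb{Z}D_{2k}$ with coefficients in $\{0,1\}$ its associated $\pm1$-matrix is $2\rho(w)-J_{2k}$. A Kimura Hadamard matrix of order $8k+4$ is a matrix \[ H=\begin{bmatrix} 1& 1 & 1 & 1 & \mathbf{1} & \mathbf{1} & \mathbf{1} & \mathbf{1}\\ 1& 1 & -1 & -1 & \mathbf{1} & \mathbf{1} & -\mathbf{1} & -\mathbf{1}\\ 1& -1 & 1 & -1 & \mathbf{1} & -\mathbf{1} & \mathbf{1} & -\mathbf{1}\\ 1& -1 & -1 & 1 & -\mathbf{1} & \mathbf{1} & \mathbf{1} & -\mathbf{1}\\ \mathbf{1}^\intercal & \mathbf{1}^\intercal & \mathbf{1}^\intercal & -\mathbf{1}^\intercal & A & B& C & D\\ \mathbf{1}^\intercal & \mathbf{1}^\intercal& -\mathbf{1}^\intercal & \mathbf{1}^\intercal & -B & A & D & -C\\ \mathbf{1}^\intercal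 & -\mathbf{1}^\intercal& \mathbf{1}^\intercal & \mathbf{1}^\intercal & -C & -D & A & B\\ \mathbf{1}^\intercal & -\mathbf{1}^\intercal& -\mathbf{1}^\intercal & -\mathbf{1}^\intercal & D & -C & B & -A \end{bmatrix} \] ($\mathbf 1$ the all-ones row vector of length $2k$) with $HH^\intercal=(8k+4)I_{8k+4}$, where $A,B,C,D$ are the $\pm1$-matrices associated to some $a,b,c,d\in\mathbb{Z}D_{2k}$ with coefficients in $\{0,1\}$. $\mathrm{Aut}(H)=\{(R,S): R,S\ \text{are}\ n\times n\ \text{signed permutation matrices},\ RHS^\intercal=H\}$. -}

module Defs where

open import Data.Nat as ℕ using (ℕ; zero; suc; NonZero; _<ᵇ_; _≡ᵇ_; _∸_)
open import Data.Nat.DivMod using (_%_)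
open import Data.Bool using (Bool; true; false; if_then_else_; _xor_; _∧_; not)
open import Data.Integer as ℤ using (ℤ; +_; -_; _*_; _+_; _-_)
open import Data.Fin using (Fin; toℕ; splitAt; remQuot; zero; suc)
open import Data.Fin.Permutation using (Permutation′; _⟨$⟩ʳ_)
open import Data.Product using (Σ; _×_; _,_)
open import Data.Sum using (_⊎_; inj₁; inj₂)
open import Relation.Binary.PropositionalEquality using (_≡_; _≢_)

Mat : ℕ → Set
Mat n = Fin n → Fin n → ℤ

sumFin : (n : ℕ) → (Fin n → ℤ) → ℤ
sumFin zero    f = + 0
sumFin (suc n) f = f zero + sumFin n (λ i → f (suc i))

_⊗_ : {n : ℕ} → Mat n → Mat n → Mat n
_⊗_ {n} M N i j = sumFin n (λ l → M i l * N l j)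

transpose : {n : ℕ} → Mat n → Mat n
transpose M i j = M j i

identity : (n : ℕ) → Mat n
identity n i j = if toℕ i ≡ᵇ toℕ j then + 1 else + 0

scale : {n : ℕ} → ℤ → Mat n → Mat n
scale c M i j = c * M i j

negM : {n : ℕ} → Mat n → Mat n
negM M i j = - M i j

_≋_ : {n : ℕ} → Mat n → Mat n → Set
M ≋ N = ∀ i j → M i j ≡ N i j

-- The dihedral group D_{2k} = ⟨x,y | x^k = y^2 = 1, y⁻¹xy = x⁻¹⟩.
-- Element with index i : Fin (2k) is x^i for toℕ i < k, and
-- x^(i-k) y for k ≤ toℕ i  (order x^0,…,x^{k-1},y,xy,…,x^{k-1}y).

-- normal form (e, s) meaning x^e y^s with 0 ≤ e < k
code : (k : ℕ) → Fin (2 ℕ.* k) → ℕ × Bool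
code k i = if toℕ i <ᵇ k then (toℕ i , false) else (toℕ i ∸ k , true)

-- (x^i y^s)(x^j y^t) = x^(i + (-1)^s j) y^(s xor t), exponent reduced mod k
mulCode : (k : ℕ) → {{NonZero k}} → ℕ × Bool → ℕ × Bool → ℕ × Bool
mulCode k (i , s) (j , t) =
  ((i ℕ.+ (if s then k ∸ j else j)) % k , s xor t)

eqCode : ℕ × Bool → ℕ × Bool → Bool
eqCode (i , s) (j , t) = (i ≡ᵇ j) ∧ not (s xor t)

δ : (k : ℕ) → {{NonZero k}} → Fin (2 ℕ.* k) → Fin (2 ℕ.* k) → Fin (2 ℕ.* k) → ℤ
δ k u g v = if eqCode (mulCode k (code k u) (code k g)) (code k v) then + 1 else + 0

-- Elements of ℤD_{2k} with coefficients in {0,1}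
Elt01 : ℕ → Set
Elt01 k = Fin (2 ℕ.* k) → Bool

bit : Bool → ℤ
bit true  = + 1
bit false = + 0

ρ : (k : ℕ) → {{NonZero k}} → Elt01 k → Mat (2 ℕ.* k)
ρ k w u v = sumFin (2 ℕ.* k) (λ g → bit (w g) * δ k u g v)

pm : (k : ℕ) → {{NonZero k}} → Elt01 k → Mat (2 ℕ.* k)
pm k w u v = + 2 * ρ k w u v - + 1

-- Kimura matrix of order 4 + 4·(2k) = 8k+4.
-- Index layout: first 4 single rows/columns, then 4 blocks of size 2k.

ord : ℕ → ℕ
ord k = 4 ℕ.+ 4 ℕ.* (2 ℕ.* k)

data Sgn : Set where
  ⊕ ⊖ : Sgn

sgn : Sgn → ℤ → ℤ
sgn ⊕ z = z
sgn ⊖ z = - z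

topLeft : Fin 4 → Fin 4 → Sgn
topLeft zero    _                   = ⊕
topLeft (suc zero) zero             = ⊕
topLeft (suc zero) (suc zero)       = ⊕
topLeft (suc zero) (suc (suc _))    = ⊖
topLeft (suc (suc zero)) zero       = ⊕
topLeft (suc (suc zero)) (suc zero) = ⊖
topLeft (suc (suc zero)) (suc (suc zero)) = ⊕
topLeft (suc (suc zero)) (suc (suc (suc _))) = ⊖
topLeft (suc (suc (suc _))) zero    = ⊕
topLeft (suc (suc (suc _))) (suc zero) = ⊖
topLeft (suc (suc (suc _))) (suc (suc zero)) = ⊖
topLeft (suc (suc (suc _))) (suc (suc (suc _))) = ⊕

topRight : Fin 4 → Fin 4 → Sgn
topRight zero _ = ⊕
topRight (suc zero) zero = ⊕
topRight (suc zero) (suc zero) = ⊕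
topRight (suc zero) (suc (suc _)) = ⊖
topRight (suc (suc zero)) zero = ⊕
topRight (suc (suc zero)) (suc zero) = ⊖
topRight (suc (suc zero)) (suc (suc zero)) = ⊕
topRight (suc (suc zero)) (suc (suc (suc _))) = ⊖
topRight (suc (suc (suc _))) zero = ⊖
topRight (suc (suc (suc _))) (suc zero) = ⊕
topRight (suc (suc (suc _))) (suc (suc zero)) = ⊕
topRight (suc (suc (suc _))) (suc (suc (suc _))) = ⊖

bottomLeft : Fin 4 → Fin 4 → Sgn
bottomLeft zero (suc (suc (suc _))) = ⊖
bottomLeft zero _ = ⊕
bottomLeft (suc zero) (suc (suc zero)) = ⊖
bottomLeft (suc zero) _ = ⊕
bottomLeft (suc (suc zero)) (suc zero) = ⊖
bottomLeft (suc (suc zero)) _ = ⊕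
bottomLeft (suc (suc (suc _))) zero = ⊕
bottomLeft (suc (suc (suc _))) _ = ⊖

data Which : Set where
  wA wB wC wD : Which

blockOf : Fin 4 → Fin 4 → Sgn × Which
blockOf zero zero = ⊕ , wA
blockOf zero (suc zero) = ⊕ , wB
blockOf zero (suc (suc zero)) = ⊕ , wC
blockOf zero (suc (suc (suc _))) = ⊕ , wD
blockOf (suc zero) zero = ⊖ , wB
blockOf (suc zero) (suc zero) = ⊕ , wA
blockOf (suc zero) (suc (suc zero)) = ⊕ , wD
blockOf (suc zero) (suc (suc (suc _))) = ⊖ , wC
blockOf (suc (suc zero)) zero = ⊖ , wC
blockOf (suc (suc zero)) (suc zero) = ⊖ , wD
blockOf (suc (suc zero)) (suc (suc zero)) = ⊕ , wA
blockOf (suc (suc zero)) (suc (suc (suc _))) = ⊕ , wB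
blockOf (suc (suc (suc _))) zero = ⊕ , wD
blockOf (suc (suc (suc _))) (suc zero) = ⊖ , wC
blockOf (suc (suc (suc _))) (suc (suc zero)) = ⊕ , wB
blockOf (suc (suc (suc _))) (suc (suc (suc _))) = ⊖ , wA

pick : {X : Set} → Which → X → X → X → X → X
pick wA a b c d = a
pick wB a b c d = b
pick wC a b c d = c
pick wD a b c d = d

kimura : (k : ℕ) → {{NonZero k}} → (a b c d : Elt01 k) → Mat (ord k)
kimura k a b c d i j with splitAt 4 i | splitAt 4 j
... | inj₁ r | inj₁ s = sgn (topLeft r s) (+ 1)
... | inj₁ r | inj₂ q with remQuot {4} (2 ℕ.* k) q
...   | (bc , _) = sgn (topRight r bc) (+ 1)
kimura k a b c d i j | inj₂ p | inj₁ s with remQuot {4} (2 ℕ.* k) p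
...   | (br , _) = sgn (bottomLeft br s) (+ 1)
kimura k a b c d i j | inj₂ p | inj₂ q with remQuot {4} (2 ℕ.* k) p | remQuot {4} (2 ℕ.* k) q
...   | (br , u) | (bc , v) with blockOf br bc
...     | (σ , w) = sgn σ (pm k (pick w a b c d) u v)

IsHadamard : {n : ℕ} → Mat n → Set
IsHadamard {n} H = (H ⊗ transpose H) ≋ scale (+ n) (identity n)

IsSign : ℤ → Set
IsSign e = (e ≡ + 1) ⊎ (e ≡ - + 1)

IsSignedPerm : {n : ℕ} → Mat n → Set
IsSignedPerm {n} M =
  Σ (Permutation′ n) λ σ → Σ (Fin n → ℤ) λ ε →
    (∀ i → IsSign (ε i)) ×
    (∀ i j → M i j ≡ (if toℕ (σ ⟨$⟩ʳ i) ≡ᵇ toℕ j then ε i else + 0))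

InAut : {n : ℕ} → Mat n → Mat n → Mat n → Set
InAut H R S = IsSignedPerm R × IsSignedPerm S × ((R ⊗ H) ⊗ transpose S) ≋ H

IsDiagonal : {n : ℕ} → Mat n → Set
IsDiagonal M = ∀ i j → i ≢ j → M i j ≡ + 0

{-# OPTIONS --safe #-}

-- Write S for the signed permutation (σ, ε). As R is diagonal, R H Sᵀ = H says
-- H i j = R i i · H i (σ j) · ε j. Row 0 of H is all ones and R 0 0 = -1, so ε = -1 and every
-- row satisfies H i = γ i · (H i ∘ σ) with γ i = -R i i. Summing a product of rows over all
-- columns is invariant under σ, so the product of the corresponding γ's is 1 whenever that
-- sum is nonzero. On the four leading columns the rows 1, 2, 3 multiply like the Klein group
-- (H₁H₂ = H₃, H₁H₂H₃ = H₀, ...), and on the block columns each of these identities holds with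
-- an extra factor -1; with the orthogonality of rows this makes Σⱼ H₁H₂H₃Hᵢ and Σⱼ HₛHₜHᵢ
-- (i a block row) equal to ±4, which forces every γ i = 1. Then each column j of H equals
-- column σ j, and since HᵀH = nI as well, σ is the identity.
module Submission where

open import Defs
open import Data.Nat as ℕ using (ℕ; zero; suc; NonZero; _<_; _<ᵇ_; _≡ᵇ_; _∸_; z≤n)
import Data.Nat.Properties as ℕP
open import Data.Nat.DivMod using (_%_; %-distribˡ-+; m%n%n≡m%n; [m+n]%n≡m%n; %-remove-+ˡ; m<n⇒m%n≡m)
open import Data.Nat.Divisibility using (m∣m*n)
open import Data.Bool using (Bool; true; false; T; not; _∧_; _xor_; if_then_else_)
open import Data.Bool.Properties using (T-∧; T-≡; not-injective; if-cong; if-float)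
open import Data.Integer as ℤ using (ℤ; +_; -_; -[1+_]; +[1+_]; +≤+)
import Data.Integer.Properties as ℤP
open import Data.Integer.Solver using (module +-*-Solver)
open import Data.Fin using (Fin; zero; suc; toℕ; _↑ˡ_; _↑ʳ_; _≟_; splitAt; remQuot)
open import Data.Fin.Patterns using (0F; 1F; 2F; 3F)
open import Data.Fin.Properties using (toℕ-injective; toℕ<n; suc-injective)
open import Data.Fin.Permutation using (Permutation′; _⟨$⟩ʳ_)
open import Data.Product using (Σ; _×_; _,_; proj₁; proj₂)
open import Data.Sum using (_⊎_; inj₁; inj₂; reduce)
import Data.Sum as Sum
open import Data.Unit using (tt)
open import Function using (_∘_; Equivalence)
open import Relation.Nullary using (¬_; yes; no; contradiction)
open import Relation.Nullary.Reflects using (ofʸ; ofⁿ)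
open import Relation.Binary.PropositionalEquality
open import Algebra.Properties.Semiring.Sum ℤP.+-*-semiring using (sum; ∑-comm; sum-permute)

open +-*-Solver using (solve; _:+_; _:*_; :-_; _:=_; con)
open ≡-Reasoning
open Equivalence using (to)

module IntegerLemmas where
  open import Data.Integer using (_+_; _*_; _≤_)

  +-mono-≤-≡⇒≡ : ∀ {a b c d} → a ≤ b → c ≤ d → a + c ≡ b + d → a ≡ b × c ≡ d
  +-mono-≤-≡⇒≡ a≤b c≤d eq =
    ℤP.≤-antisym a≤b (ℤP.≮⇒≥ λ a<b → ℤP.<-irrefl eq (ℤP.+-mono-<-≤ a<b c≤d)) ,
    ℤP.≤-antisym c≤d (ℤP.≮⇒≥ λ c<d → ℤP.<-irrefl eq (ℤP.+-mono-≤-< a≤b c<d))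

  x*x≥0 : ∀ x → + 0 ≤ x * x
  x*x≥0 (+ zero)  = +≤+ z≤n
  x*x≥0 +[1+ _ ] = +≤+ z≤n
  x*x≥0 -[1+ _ ] = +≤+ z≤n

  x*x≡0⇒x≡0 : ∀ x → x * x ≡ + 0 → x ≡ + 0
  x*x≡0⇒x≡0 x eq = reduce (ℤP.i*j≡0⇒i≡0∨j≡0 x eq)

  IsSign-neg : ∀ {e} → IsSign e → IsSign (- e)
  IsSign-neg (inj₁ refl) = inj₂ refl
  IsSign-neg (inj₂ refl) = inj₁ refl

  IsSign⇒e*e≡1 : ∀ {e} → IsSign e → e * e ≡ + 1
  IsSign⇒e*e≡1 (inj₁ refl) = refl
  IsSign⇒e*e≡1 (inj₂ refl) = refl

  klein-signs : ∀ {x₁ x₂ x₃ y} →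
    x₁ * x₂ * y ≡ + 1 → x₁ * x₃ * y ≡ + 1 → x₂ * x₃ * y ≡ + 1 → x₁ * x₂ * x₃ * y ≡ + 1 →
    x₁ ≡ + 1 × x₂ ≡ + 1 × x₃ ≡ + 1
  klein-signs {x₁} {x₂} {x₃} {y} h₁₂ h₁₃ h₂₃ h₁₂₃ =
    factor x₁ h₂₃ (solve 4 (λ a b c e → a :* (b :* c :* e) := a :* b :* c :* e) refl x₁ x₂ x₃ y) ,
    factor x₂ h₁₃ (solve 4 (λ a b c e → b :* (a :* c :* e) := a :* b :* c :* e) refl x₁ x₂ x₃ y) ,
    factor x₃ h₁₂ (solve 4 (λ a b c e → c :* (a :* b :* e) := a :* b :* c :* e) refl x₁ x₂ x₃ y)
    where
    factor : ∀ x {e} → e ≡ + 1 → x * e ≡ x₁ * x₂ * x₃ * y → x ≡ + 1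
    factor x {e} e≡1 xe≡ = begin
      x                  ≡⟨ ℤP.*-identityʳ x ⟨
      x * + 1            ≡⟨ cong (x *_) e≡1 ⟨
      x * e              ≡⟨ xe≡ ⟩
      x₁ * x₂ * x₃ * y   ≡⟨ h₁₂₃ ⟩
      + 1                ∎

open IntegerLemmas

module FiniteSums where
  open import Data.Integer using (_+_; _*_; _≤_)

  sumFin≡sum : ∀ n (f : Fin n → ℤ) → sumFin n f ≡ sum f
  sumFin≡sum zero    f = refl
  sumFin≡sum (suc n) f = cong (λ x → f zero + x) (sumFin≡sum n (f ∘ suc))

  sumFin-cong : ∀ n {f g : Fin n → ℤ} → f ≗ g → sumFin n f ≡ sumFin n g
  sumFin-cong zero    f≗g = refl
  sumFin-cong (suc n) f≗g = cong₂ _+_ (f≗g zero) (sumFin-cong n (f≗g ∘ suc))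

  sumFin-zero : ∀ n {f : Fin n → ℤ} → (∀ i → f i ≡ + 0) → sumFin n f ≡ + 0
  sumFin-zero zero    f≡0 = refl
  sumFin-zero (suc n) f≡0 = cong₂ _+_ (f≡0 zero) (sumFin-zero n (f≡0 ∘ suc))

  sumFin-ones : ∀ n → sumFin n (λ _ → + 1) ≡ + n
  sumFin-ones zero    = refl
  sumFin-ones (suc n) = cong (λ x → + 1 + x) (sumFin-ones n)

  sumFin-neg : ∀ n (f : Fin n → ℤ) → sumFin n (λ i → - f i) ≡ - sumFin n f
  sumFin-neg zero    f = refl
  sumFin-neg (suc n) f =
    trans (cong (λ x → - f zero + x) (sumFin-neg n (f ∘ suc))) (sym (ℤP.neg-distrib-+ (f zero) _))

  sumFin-*ˡ : ∀ n x (f : Fin n → ℤ) → sumFin n (λ i → x * f i) ≡ x * sumFin n f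
  sumFin-*ˡ zero    x f = sym (ℤP.*-zeroʳ x)
  sumFin-*ˡ (suc n) x f =
    trans (cong (λ y → x * f zero + y) (sumFin-*ˡ n x (f ∘ suc))) (sym (ℤP.*-distribˡ-+ x (f zero) _))

  sumFin-*-sumFin : ∀ m n (f : Fin m → ℤ) (g : Fin n → ℤ) →
    sumFin m f * sumFin n g ≡ sumFin m (λ i → sumFin n (λ j → f i * g j))
  sumFin-*-sumFin m n f g = begin
    sumFin m f * sumFin n g                     ≡⟨ ℤP.*-comm (sumFin m f) _ ⟩
    sumFin n g * sumFin m f                     ≡⟨ sumFin-*ˡ m (sumFin n g) f ⟨
    sumFin m (λ i → sumFin n g * f i)           ≡⟨ sumFin-cong m (λ i → ℤP.*-comm (sumFin n g) (f i)) ⟩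
    sumFin m (λ i → f i * sumFin n g)           ≡⟨ sumFin-cong m (λ i → sumFin-*ˡ n (f i) g) ⟨
    sumFin m (λ i → sumFin n (λ j → f i * g j)) ∎

  sumFin-comm : ∀ m n (f : Fin m → Fin n → ℤ) →
    sumFin m (λ i → sumFin n (f i)) ≡ sumFin n (λ j → sumFin m (λ i → f i j))
  sumFin-comm m n f = begin
    sumFin m (λ i → sumFin n (f i))          ≡⟨ sumFin-cong m (λ i → sumFin≡sum n (f i)) ⟩
    sumFin m (λ i → sum (f i))               ≡⟨ sumFin≡sum m _ ⟩
    sum (λ i → sum (f i))                    ≡⟨ ∑-comm f ⟩
    sum (λ j → sum (λ i → f i j))            ≡⟨ sumFin≡sum n _ ⟨
    sumFin n (λ j → sum (λ i → f i j))       ≡⟨ sumFin-cong n (λ j → sumFin≡sum m (λ i → f i j)) ⟨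
    sumFin n (λ j → sumFin m (λ i → f i j))  ∎

  sumFin-permute : ∀ n (π : Permutation′ n) (f : Fin n → ℤ) →
    sumFin n (λ j → f (π ⟨$⟩ʳ j)) ≡ sumFin n f
  sumFin-permute n π f = begin
    sumFin n (λ j → f (π ⟨$⟩ʳ j))  ≡⟨ sumFin≡sum n _ ⟩
    sum (λ j → f (π ⟨$⟩ʳ j))       ≡⟨ sum-permute f π ⟨
    sum f                          ≡⟨ sumFin≡sum n f ⟨
    sumFin n f                     ∎

  sumFin-delta : ∀ n (f : Fin n → ℤ) i → (∀ j → j ≢ i → f j ≡ + 0) → sumFin n f ≡ f i
  sumFin-delta (suc n) f zero    f≡0 =
    trans (cong (λ x → f zero + x) (sumFin-zero n (λ j → f≡0 (suc j) λ ()))) (ℤP.+-identityʳ (f zero))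
  sumFin-delta (suc n) f (suc i) f≡0 =
    trans (cong (_+ sumFin n (f ∘ suc)) (f≡0 zero λ ()))
      (trans (ℤP.+-identityˡ _)
        (sumFin-delta n (f ∘ suc) i (λ j j≢i → f≡0 (suc j) (j≢i ∘ suc-injective))))

  sumFin-↑ : ∀ l m (f : Fin (l ℕ.+ m) → ℤ) →
    sumFin (l ℕ.+ m) f ≡ sumFin l (λ c → f (c ↑ˡ m)) + sumFin m (λ q → f (l ↑ʳ q))
  sumFin-↑ zero    m f = sym (ℤP.+-identityˡ _)
  sumFin-↑ (suc l) m f =
    trans (cong (λ x → f zero + x) (sumFin-↑ l m (f ∘ suc))) (sym (ℤP.+-assoc (f zero) _ _))

  sumFin-twist : ∀ l m (f g : Fin (l ℕ.+ m) → ℤ) →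
    (∀ c → f (c ↑ˡ m) ≡ g (c ↑ˡ m)) → (∀ q → f (l ↑ʳ q) ≡ - g (l ↑ʳ q)) →
    sumFin (l ℕ.+ m) f + sumFin (l ℕ.+ m) g ≡ + 2 * sumFin l (λ c → g (c ↑ˡ m))
  sumFin-twist l m f g f≡g f≡-g = begin
    sumFin (l ℕ.+ m) f + sumFin (l ℕ.+ m) g
      ≡⟨ cong₂ _+_ (sumFin-↑ l m f) (sumFin-↑ l m g) ⟩
    (sumFin l (λ c → f (c ↑ˡ m)) + sumFin m (λ q → f (l ↑ʳ q))) + (G + B)
      ≡⟨ cong₂ (λ x y → (x + y) + (G + B))
           (sumFin-cong l f≡g) (trans (sumFin-cong m f≡-g) (sumFin-neg m _)) ⟩
    (G + - B) + (G + B)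
      ≡⟨ solve 2 (λ x y → (x :+ :- y) :+ (x :+ y) := con (+ 2) :* x) refl G B ⟩
    + 2 * G ∎
    where
    G = sumFin l (λ c → g (c ↑ˡ m))
    B = sumFin m (λ q → g (l ↑ʳ q))

  sumFin-mono : ∀ n {f g : Fin n → ℤ} → (∀ i → f i ≤ g i) → sumFin n f ≤ sumFin n g
  sumFin-mono zero    f≤g = ℤP.≤-refl
  sumFin-mono (suc n) f≤g = ℤP.+-mono-≤ (f≤g zero) (sumFin-mono n (f≤g ∘ suc))

  sumFin-mono-≡⇒≗ : ∀ n {f g : Fin n → ℤ} → (∀ i → f i ≤ g i) → sumFin n f ≡ sumFin n g → f ≗ g
  sumFin-mono-≡⇒≗ (suc n) f≤g eq zero    =
    proj₁ (+-mono-≤-≡⇒≡ (f≤g zero) (sumFin-mono n (f≤g ∘ suc)) eq)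
  sumFin-mono-≡⇒≗ (suc n) f≤g eq (suc i) =
    sumFin-mono-≡⇒≗ n (f≤g ∘ suc) (proj₂ (+-mono-≤-≡⇒≡ (f≤g zero) (sumFin-mono n (f≤g ∘ suc)) eq)) i

  IsBit : ℤ → Set
  IsBit z = (z ≡ + 0) ⊎ (z ≡ + 1)

  sumFin-bits-atMostOne : ∀ n (f : Fin n → Bool) → (∀ i j → T (f i) → T (f j) → i ≡ j) →
    IsBit (sumFin n (λ i → bit (f i)))
  sumFin-bits-atMostOne zero    f unique = inj₁ refl
  sumFin-bits-atMostOne (suc n) f unique with f zero in f₀≡
  ... | false = Sum.map (trans (ℤP.+-identityˡ _)) (trans (ℤP.+-identityˡ _))
                  (sumFin-bits-atMostOne n (f ∘ suc) λ i j fi fj → suc-injective (unique (suc i) (suc j) fi fj))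
  ... | true  = inj₂ (cong (λ x → + 1 + x) (sumFin-zero n rest≡0))
    where
    rest≡0 : ∀ i → bit (f (suc i)) ≡ + 0
    rest≡0 i with f (suc i) in fᵢ≡
    ... | false = refl
    ... | true  with unique zero (suc i) (subst T (sym f₀≡) tt) (subst T (sym fᵢ≡) tt)
    ...   | ()

open FiniteSums

module ModularArithmetic where

  [m+n%d]%d≡[m+n]%d : ∀ m n d .{{_ : NonZero d}} → (m ℕ.+ n % d) % d ≡ (m ℕ.+ n) % d
  [m+n%d]%d≡[m+n]%d m n d = begin
    (m ℕ.+ n % d) % d          ≡⟨ %-distribˡ-+ m (n % d) d ⟩
    (m % d ℕ.+ n % d % d) % d  ≡⟨ cong (λ x → (m % d ℕ.+ x) % d) (m%n%n≡m%n n d) ⟩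
    (m % d ℕ.+ n % d) % d      ≡⟨ %-distribˡ-+ m n d ⟨
    (m ℕ.+ n) % d              ∎

  +-%-congˡ : ∀ m {x y} d .{{_ : NonZero d}} → x % d ≡ y % d → (m ℕ.+ x) % d ≡ (m ℕ.+ y) % d
  +-%-congˡ m {x} {y} d eq = begin
    (m ℕ.+ x) % d      ≡⟨ [m+n%d]%d≡[m+n]%d m x d ⟨
    (m ℕ.+ x % d) % d  ≡⟨ cong (λ z → (m ℕ.+ z) % d) eq ⟩
    (m ℕ.+ y % d) % d  ≡⟨ [m+n%d]%d≡[m+n]%d m y d ⟩
    (m ℕ.+ y) % d      ∎

  -- (d ∸ 1) * m is an additive inverse of m modulo d.
  +-%-cancelˡ : ∀ m {x y} d .{{_ : NonZero d}} → (m ℕ.+ x) % d ≡ (m ℕ.+ y) % d → x % d ≡ y % d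
  +-%-cancelˡ m {x} {y} d@(suc d-1) eq =
    trans (sym (shift x)) (trans (+-%-congˡ (d-1 ℕ.* m) d eq) (shift y))
    where
    shift : ∀ z → (d-1 ℕ.* m ℕ.+ (m ℕ.+ z)) % d ≡ z % d
    shift z = trans
      (cong (_% d) (trans (sym (ℕP.+-assoc (d-1 ℕ.* m) m z)) (cong (ℕ._+ z) (ℕP.+-comm (d-1 ℕ.* m) m))))
      (%-remove-+ˡ z (m∣m*n m))

  %-injective-< : ∀ {x y d} .{{_ : NonZero d}} → x < d → y < d → x % d ≡ y % d → x ≡ y
  %-injective-< x<d y<d eq = trans (sym (m<n⇒m%n≡m x<d)) (trans eq (m<n⇒m%n≡m y<d))

  ∸-%-cancel : ∀ {x y d} .{{_ : NonZero d}} → x ℕ.≤ d → y ℕ.≤ d → (d ∸ x) % d ≡ (d ∸ y) % d → x % d ≡ y % d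
  ∸-%-cancel {x} {y} {d} x≤d y≤d eq = begin
    x % d                        ≡⟨ complete x y≤d ⟨
    (x ℕ.+ y ℕ.+ (d ∸ y)) % d    ≡⟨ +-%-congˡ (x ℕ.+ y) d eq ⟨
    (x ℕ.+ y ℕ.+ (d ∸ x)) % d    ≡⟨ cong (λ z → (z ℕ.+ (d ∸ x)) % d) (ℕP.+-comm x y) ⟩
    (y ℕ.+ x ℕ.+ (d ∸ x)) % d    ≡⟨ complete y x≤d ⟩
    y % d                        ∎
    where
    complete : ∀ m {z} → z ℕ.≤ d → (m ℕ.+ z ℕ.+ (d ∸ z)) % d ≡ m % d
    complete m {z} z≤d =
      trans (cong (_% d) (trans (ℕP.+-assoc m z (d ∸ z)) (cong (m ℕ.+_) (ℕP.m+[n∸m]≡n z≤d))))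
        ([m+n]%n≡m%n m d)

open ModularArithmetic

module DihedralRegularRepresentation where
  open import Data.Integer using (_*_)

  mulCode-cancelˡ : ∀ k {{_ : NonZero k}} x y y' → proj₁ y < k → proj₁ y' < k →
    mulCode k x y ≡ mulCode k x y' → y ≡ y'
  mulCode-cancelˡ k (i , false) (j , t) (j' , t') j<k j'<k eq =
    cong₂ _,_ (%-injective-< j<k j'<k (+-%-cancelˡ i k (cong proj₁ eq))) (cong proj₂ eq)
  mulCode-cancelˡ k (i , true) (j , t) (j' , t') j<k j'<k eq =
    cong₂ _,_
      (%-injective-< j<k j'<k (∸-%-cancel (ℕP.<⇒≤ j<k) (ℕP.<⇒≤ j'<k) (+-%-cancelˡ i k (cong proj₁ eq))))
      (not-injective (cong proj₂ eq))

  code-bound : ∀ k {{_ : NonZero k}} (g : Fin (2 ℕ.* k)) → proj₁ (code k g) < k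
  code-bound k g with toℕ g <ᵇ k | ℕP.<ᵇ-reflects-< (toℕ g) k
  ... | true  | ofʸ g<k = g<k
  ... | false | ofⁿ _   =
    ℕP.m<n+o⇒m∸n<o (toℕ g) k (subst (toℕ g <_) (cong (k ℕ.+_) (ℕP.+-identityʳ k)) (toℕ<n g))

  code-injective : ∀ k {g g' : Fin (2 ℕ.* k)} → code k g ≡ code k g' → g ≡ g'
  code-injective k {g} {g'} eq
    with toℕ g <ᵇ k | ℕP.<ᵇ-reflects-< (toℕ g) k | toℕ g' <ᵇ k | ℕP.<ᵇ-reflects-< (toℕ g') k
  ... | true  | _       | true  | _        = toℕ-injective (cong proj₁ eq)
  ... | false | ofⁿ g≮k | false | ofⁿ g'≮k =
    toℕ-injective (ℕP.∸-cancelʳ-≡ (ℕP.≮⇒≥ g≮k) (ℕP.≮⇒≥ g'≮k) (cong proj₁ eq))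
  ... | true  | _       | false | _        = contradiction (cong proj₂ eq) λ ()
  ... | false | _       | true  | _        = contradiction (cong proj₂ eq) λ ()

  T-not-xor⇒≡ : ∀ s t → T (not (s xor t)) → s ≡ t
  T-not-xor⇒≡ false false _ = refl
  T-not-xor⇒≡ false true  ()
  T-not-xor⇒≡ true  false ()
  T-not-xor⇒≡ true  true  _ = refl

  eqCode-sound : ∀ x y → T (eqCode x y) → x ≡ y
  eqCode-sound (i , s) (j , t) x≡y with to T-∧ x≡y
  ... | i≡j , s≡t = cong₂ _,_ (ℕP.≡ᵇ⇒≡ i j i≡j) (T-not-xor⇒≡ s t s≡t)

  left-quotient-unique : ∀ k {{_ : NonZero k}} {u v g g'} →
    T (eqCode (mulCode k (code k u) (code k g)) (code k v)) →
    T (eqCode (mulCode k (code k u) (code k g')) (code k v)) → g ≡ g'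
  left-quotient-unique k {u} {v} {g} {g'} ug≡v ug'≡v =
    code-injective k (mulCode-cancelˡ k (code k u) (code k g) (code k g') (code-bound k g) (code-bound k g')
      (trans (eqCode-sound _ _ ug≡v) (sym (eqCode-sound _ _ ug'≡v))))

  bit-*-if : ∀ b c → bit b * (if c then + 1 else + 0) ≡ bit (b ∧ c)
  bit-*-if false c     = refl
  bit-*-if true  false = refl
  bit-*-if true  true  = refl

  ρ-bit : ∀ k {{_ : NonZero k}} w u v → IsBit (ρ k w u v)
  ρ-bit k w u v = subst IsBit (sym ρ≡) (sumFin-bits-atMostOne (2 ℕ.* k) f unique)
    where
    f : Fin (2 ℕ.* k) → Bool
    f g = w g ∧ eqCode (mulCode k (code k u) (code k g)) (code k v)
    ρ≡ : ρ k w u v ≡ sumFin (2 ℕ.* k) (λ g → bit (f g))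
    ρ≡ = sumFin-cong (2 ℕ.* k) (λ g → bit-*-if (w g) _)
    unique : ∀ g g' → T (f g) → T (f g') → g ≡ g'
    unique g g' fg fg' = left-quotient-unique k {u} {v} (proj₂ (to (T-∧ {w g}) fg)) (proj₂ (to (T-∧ {w g'}) fg'))

  pm-sign : ∀ k {{_ : NonZero k}} w u v → IsSign (pm k w u v)
  pm-sign k w u v with ρ k w u v | ρ-bit k w u v
  ... | _ | inj₁ refl = inj₂ refl
  ... | _ | inj₂ refl = inj₁ refl

open DihedralRegularRepresentation

module HadamardMatrices where
  open import Data.Integer using (_*_; _≤_)

  ¬T⇒≡false : ∀ {b} → ¬ T b → b ≡ false
  ¬T⇒≡false {false} _  = refl
  ¬T⇒≡false {true}  ¬t = contradiction tt ¬t

  if-toℕ-≡ᵇ-refl : ∀ {n} (i : Fin n) {A : Set} {x y : A} → (if toℕ i ≡ᵇ toℕ i then x else y) ≡ x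
  if-toℕ-≡ᵇ-refl i = if-cong (to T-≡ (ℕP.≡⇒≡ᵇ (toℕ i) (toℕ i) refl))

  if-toℕ-≡ᵇ-≢ : ∀ {n} {i j : Fin n} {A : Set} {x y : A} → i ≢ j → (if toℕ i ≡ᵇ toℕ j then x else y) ≡ y
  if-toℕ-≡ᵇ-≢ {i = i} {j} i≢j = if-cong (¬T⇒≡false (i≢j ∘ toℕ-injective ∘ ℕP.≡ᵇ⇒≡ (toℕ i) (toℕ j)))

  identity-diag : ∀ {n} (i : Fin n) → identity n i i ≡ + 1
  identity-diag i = if-toℕ-≡ᵇ-refl i

  identity-offdiag : ∀ {n} {i j : Fin n} → i ≢ j → identity n i j ≡ + 0
  identity-offdiag = if-toℕ-≡ᵇ-≢

  hadamard-rows-orthogonal : ∀ {n} {H : Mat n} → IsHadamard H →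
    ∀ {i j} → i ≢ j → sumFin n (λ l → H i l * H j l) ≡ + 0
  hadamard-rows-orthogonal {n} had {i} {j} i≢j =
    trans (had i j) (trans (cong (+ n *_) (identity-offdiag i≢j)) (ℤP.*-zeroʳ (+ n)))

  frob² : ∀ {n} → Mat n → ℤ
  frob² {n} M = sumFin n (λ i → sumFin n (λ j → M i j * M i j))

  frob²-cong : ∀ {n} {M N : Mat n} → M ≋ N → frob² M ≡ frob² N
  frob²-cong {n} M≋N = sumFin-cong n (λ i → sumFin-cong n (λ j → cong₂ _*_ (M≋N i j) (M≋N i j)))

  frob²-transpose-⊗ : ∀ {n} (M : Mat n) → frob² (transpose M ⊗ M) ≡ frob² (M ⊗ transpose M)
  frob²-transpose-⊗ {n} M = begin
    frob² (transpose M ⊗ M)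
      ≡⟨ ΣΣ-cong (λ l l' → sumFin-*-sumFin n n (λ t → M t l * M t l') (λ t → M t l * M t l')) ⟩
    ΣΣ (λ l l' → ΣΣ (λ t t' → (M t l * M t l') * (M t' l * M t' l')))
      ≡⟨ swap (λ l l' t t' → (M t l * M t l') * (M t' l * M t' l')) ⟩
    ΣΣ (λ t t' → ΣΣ (λ l l' → (M t l * M t l') * (M t' l * M t' l')))
      ≡⟨ ΣΣ-cong (λ t t' → ΣΣ-cong (λ l l' →
           solve 4 (λ a b c d → (a :* b) :* (c :* d) := (a :* c) :* (b :* d)) refl
             (M t l) (M t l') (M t' l) (M t' l'))) ⟩
    ΣΣ (λ t t' → ΣΣ (λ l l' → (M t l * M t' l) * (M t l' * M t' l')))
      ≡⟨ ΣΣ-cong (λ t t' → sumFin-*-sumFin n n (λ l → M t l * M t' l) (λ l → M t l * M t' l)) ⟨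
    frob² (M ⊗ transpose M) ∎
    where
    ΣΣ : (Fin n → Fin n → ℤ) → ℤ
    ΣΣ f = sumFin n (λ i → sumFin n (f i))
    ΣΣ-cong : ∀ {f g} → (∀ i j → f i j ≡ g i j) → ΣΣ f ≡ ΣΣ g
    ΣΣ-cong f≡g = sumFin-cong n (λ i → sumFin-cong n (f≡g i))
    swap : ∀ (F : Fin n → Fin n → Fin n → Fin n → ℤ) →
      ΣΣ (λ l l' → ΣΣ (F l l')) ≡ ΣΣ (λ t t' → ΣΣ (λ l l' → F l l' t t'))
    swap F = begin
      sumFin n (λ l → sumFin n (λ l' → sumFin n (λ t → sumFin n (λ t' → F l l' t t'))))
        ≡⟨ sumFin-cong n (λ l → sumFin-comm n n (λ l' t → sumFin n (F l l' t))) ⟩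
      sumFin n (λ l → sumFin n (λ t → sumFin n (λ l' → sumFin n (λ t' → F l l' t t'))))
        ≡⟨ sumFin-comm n n (λ l t → sumFin n (λ l' → sumFin n (F l l' t))) ⟩
      sumFin n (λ t → sumFin n (λ l → sumFin n (λ l' → sumFin n (λ t' → F l l' t t'))))
        ≡⟨ sumFin-cong n (λ t → sumFin-cong n (λ l → sumFin-comm n n (λ l' t' → F l l' t t'))) ⟩
      sumFin n (λ t → sumFin n (λ l → sumFin n (λ t' → sumFin n (λ l' → F l l' t t'))))
        ≡⟨ sumFin-cong n (λ t → sumFin-comm n n (λ l t' → sumFin n (λ l' → F l l' t t'))) ⟩
      sumFin n (λ t → sumFin n (λ t' → sumFin n (λ l → sumFin n (λ l' → F l l' t t')))) ∎

  -- Squared Frobenius norms: ‖HᵀH‖² = ‖HHᵀ‖² = ‖nI‖², and the diagonal of HᵀH (equal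
  -- to n, as the entries are ±1) already accounts for all of ‖nI‖².
  transpose-hadamard : ∀ {n} {H : Mat n} → IsHadamard H → (∀ i j → IsSign (H i j)) →
    IsHadamard (transpose H)
  transpose-hadamard {n} {H} had ±1 = G≡D
    where
    G D : Mat n
    G = transpose H ⊗ H
    D = scale (+ n) (identity n)
    G-diag : ∀ l → G l l ≡ + n
    G-diag l = trans (sumFin-cong n (λ t → IsSign⇒e*e≡1 (±1 t l))) (sumFin-ones n)
    D-diag : ∀ l → D l l ≡ + n
    D-diag l = trans (cong (+ n *_) (identity-diag l)) (ℤP.*-identityʳ (+ n))
    D-offdiag : ∀ {l l'} → l ≢ l' → D l l' ≡ + 0
    D-offdiag l≢l' = trans (cong (+ n *_) (identity-offdiag l≢l')) (ℤP.*-zeroʳ (+ n))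
    D²≤G² : ∀ l l' → D l l' * D l l' ≤ G l l' * G l l'
    D²≤G² l l' with l ≟ l'
    ... | yes refl = ℤP.≤-reflexive (cong (λ x → x * x) (trans (D-diag l) (sym (G-diag l))))
    ... | no l≢l'  = subst (_≤ G l l' * G l l') (sym (cong (λ x → x * x) (D-offdiag l≢l'))) (x*x≥0 (G l l'))
    D²≡G² : ∀ l l' → D l l' * D l l' ≡ G l l' * G l l'
    D²≡G² l = sumFin-mono-≡⇒≗ n (D²≤G² l)
      (sumFin-mono-≡⇒≗ n (λ l → sumFin-mono n (D²≤G² l)) (sym (trans (frob²-transpose-⊗ H) (frob²-cong had))) l)
    G≡D : G ≋ D
    G≡D l l' with l ≟ l'
    ... | yes refl = trans (G-diag l) (sym (D-diag l))
    ... | no l≢l'  = trans (x*x≡0⇒x≡0 _ (trans (sym (D²≡G² l l')) (cong (λ x → x * x) (D-offdiag l≢l'))))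
                           (sym (D-offdiag l≢l'))

  hadamard-equal-columns : ∀ {n} {H : Mat n} → IsHadamard H → (∀ i j → IsSign (H i j)) →
    ∀ {l l'} → (∀ t → H t l ≡ H t l') → l ≡ l'
  hadamard-equal-columns {zero}  _   _  {()}
  hadamard-equal-columns {suc n} {H} had ±1 {l} {l'} columns with l ≟ l'
  ... | yes l≡l' = l≡l'
  ... | no  l≢l' = contradiction n+1≡0 λ ()
    where
    n+1≡0 : + suc n ≡ + 0
    n+1≡0 = begin
      + suc n
        ≡⟨ sumFin-ones (suc n) ⟨
      sumFin (suc n) (λ _ → + 1)
        ≡⟨ sumFin-cong (suc n) (λ t → trans (sym (IsSign⇒e*e≡1 (±1 t l))) (cong (H t l *_) (columns t))) ⟩
      sumFin (suc n) (λ t → H t l * H t l')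
        ≡⟨ hadamard-rows-orthogonal {H = transpose H} (transpose-hadamard had ±1) l≢l' ⟩
      + 0 ∎

open HadamardMatrices

module SignedPermutationAction where
  open import Data.Integer using (_*_)

  SignedPermEntries : ∀ {n} → Permutation′ n → (Fin n → ℤ) → Mat n → Set
  SignedPermEntries σ ε S = ∀ i j → S i j ≡ (if toℕ (σ ⟨$⟩ʳ i) ≡ᵇ toℕ j then ε i else + 0)

  record Eigen {n} (σ : Permutation′ n) (γ : ℤ) (f : Fin n → ℤ) : Set where
    constructor eigen
    field scaled : ∀ j → f j ≡ γ * f (σ ⟨$⟩ʳ j)

  eigen-* : ∀ {n} {σ : Permutation′ n} {α β f g} → Eigen σ α f → Eigen σ β g →
    Eigen σ (α * β) (λ j → f j * g j)
  eigen-* {σ = σ} {α} {β} {f} {g} (eigen ef) (eigen eg) = eigen λ j → trans (cong₂ _*_ (ef j) (eg j))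
    (solve 4 (λ a b x y → (a :* x) :* (b :* y) := (a :* b) :* (x :* y)) refl α β (f (σ ⟨$⟩ʳ j)) (g (σ ⟨$⟩ʳ j)))

  eigen-sum≢0⇒≡1 : ∀ {n} {σ : Permutation′ n} {γ f} → Eigen σ γ f → sumFin n f ≢ + 0 → γ ≡ + 1
  eigen-sum≢0⇒≡1 {n} {σ} {γ} {f} (eigen ef) Σf≢0 =
    sym (ℤP.*-cancelʳ-≡ (+ 1) γ (sumFin n f) {{ℤ.≢-nonZero Σf≢0}} (trans (ℤP.*-identityˡ _) Σf≡γΣf))
    where
    Σf≡γΣf : sumFin n f ≡ γ * sumFin n f
    Σf≡γΣf = begin
      sumFin n f                         ≡⟨ sumFin-cong n ef ⟩
      sumFin n (λ j → γ * f (σ ⟨$⟩ʳ j))  ≡⟨ sumFin-*ˡ n γ _ ⟩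
      γ * sumFin n (λ j → f (σ ⟨$⟩ʳ j))  ≡⟨ cong (γ *_) (sumFin-permute n σ f) ⟩
      γ * sumFin n f                     ∎

  diagonal-⊗ : ∀ {n} {R : Mat n} → IsDiagonal R → ∀ (M : Mat n) i l → (R ⊗ M) i l ≡ R i i * M i l
  diagonal-⊗ {n} {R} diag M i l =
    sumFin-delta n (λ p → R i p * M p l) i (λ p p≢i → cong (_* M p l) (diag i p (p≢i ∘ sym)))

  ⊗-transpose-signedPerm : ∀ {n} {S : Mat n} {σ : Permutation′ n} {ε : Fin n → ℤ} →
    SignedPermEntries σ ε S →
    ∀ (M : Mat n) i j → (M ⊗ transpose S) i j ≡ M i (σ ⟨$⟩ʳ j) * ε j
  ⊗-transpose-signedPerm {n} {S} {σ} {ε} S≡ M i j =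
    trans (sumFin-delta n (λ l → M i l * S j l) (σ ⟨$⟩ʳ j) off)
      (cong (M i (σ ⟨$⟩ʳ j) *_) (trans (S≡ j _) (if-toℕ-≡ᵇ-refl (σ ⟨$⟩ʳ j))))
    where
    off : ∀ l → l ≢ σ ⟨$⟩ʳ j → M i l * S j l ≡ + 0
    off l l≢σj = trans (cong (M i l *_) (trans (S≡ j l) (if-toℕ-≡ᵇ-≢ (l≢σj ∘ sym)))) (ℤP.*-zeroʳ (M i l))

  diagonal-≋-negI : ∀ {n} {R : Mat n} → IsDiagonal R → (∀ i → R i i ≡ - + 1) → R ≋ negM (identity n)
  diagonal-≋-negI diag R≡-1 i j with i ≟ j
  ... | yes refl = trans (R≡-1 i) (cong -_ (sym (identity-diag i)))
  ... | no  i≢j  = trans (diag i j i≢j) (cong -_ (sym (identity-offdiag i≢j)))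

  signedPerm-≋-negI : ∀ {n} {S : Mat n} {σ : Permutation′ n} {ε : Fin n → ℤ} →
    SignedPermEntries σ ε S →
    (∀ i → σ ⟨$⟩ʳ i ≡ i) → (∀ i → ε i ≡ - + 1) → S ≋ negM (identity n)
  signedPerm-≋-negI S≡ σ≡id ε≡-1 i j =
    trans (S≡ i j) (trans (cong₂ (λ x e → if toℕ x ≡ᵇ toℕ j then e else + 0) (σ≡id i) (ε≡-1 i))
      (sym (if-float -_ (toℕ i ≡ᵇ toℕ j))))

  diagonal-signedPerm-action : ∀ {n} {H R S : Mat n} {σ : Permutation′ n} {ε : Fin n → ℤ} →
    IsDiagonal R → SignedPermEntries σ ε S →
    ((R ⊗ H) ⊗ transpose S) ≋ H → ∀ i j → H i j ≡ R i i * H i (σ ⟨$⟩ʳ j) * ε j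
  diagonal-signedPerm-action {H = H} {R} {S} {σ} {ε} diag S≡ RHSᵀ≋H i j = begin
    H i j                          ≡⟨ RHSᵀ≋H i j ⟨
    ((R ⊗ H) ⊗ transpose S) i j    ≡⟨ ⊗-transpose-signedPerm {σ = σ} {ε} S≡ (R ⊗ H) i j ⟩
    (R ⊗ H) i (σ ⟨$⟩ʳ j) * ε j     ≡⟨ cong (_* ε j) (diagonal-⊗ diag H i (σ ⟨$⟩ʳ j)) ⟩
    R i i * H i (σ ⟨$⟩ʳ j) * ε j   ∎

  eigen-1⇒invariant : ∀ {n} {σ : Permutation′ n} {γ f} → Eigen σ γ f → γ ≡ + 1 → ∀ j → f j ≡ f (σ ⟨$⟩ʳ j)
  eigen-1⇒invariant {σ = σ} {f = f} (eigen ef) γ≡1 j =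
    trans (ef j) (trans (cong (_* f (σ ⟨$⟩ʳ j)) γ≡1) (ℤP.*-identityˡ (f (σ ⟨$⟩ʳ j))))

  diagonal-aut-eigen : ∀ {n} {H R S : Mat n} {σ : Permutation′ n} {ε : Fin n → ℤ} →
    IsDiagonal R → SignedPermEntries σ ε S →
    ((R ⊗ H) ⊗ transpose S) ≋ H → ∀ i₀ → (∀ j → H i₀ j ≡ + 1) → R i₀ i₀ ≡ - + 1 →
    (∀ j → ε j ≡ - + 1) × (∀ i → Eigen σ (- R i i) (H i))
  diagonal-aut-eigen {H = H} {R} {σ = σ} {ε} diag S≡ RHSᵀ≋H i₀ row≡1 R≡-1 = ε≡-1 , λ i → eigen (row-eigen i)
    where
    action : ∀ i j → H i j ≡ R i i * H i (σ ⟨$⟩ʳ j) * ε j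
    action = diagonal-signedPerm-action {σ = σ} {ε} diag S≡ RHSᵀ≋H
    ε≡-1 : ∀ j → ε j ≡ - + 1
    ε≡-1 j = begin
      ε j                                  ≡⟨ ℤP.neg-involutive (ε j) ⟨
      - - ε j                              ≡⟨ cong -_ (ℤP.-1*i≡-i (ε j)) ⟨
      - (- + 1 * ε j)                      ≡⟨ cong (λ x → - (x * ε j)) (cong₂ _*_ R≡-1 (row≡1 (σ ⟨$⟩ʳ j))) ⟨
      - (R i₀ i₀ * H i₀ (σ ⟨$⟩ʳ j) * ε j)  ≡⟨ cong -_ (action i₀ j) ⟨
      - H i₀ j                             ≡⟨ cong -_ (row≡1 j) ⟩
      - + 1                                ∎
    row-eigen : ∀ i j → H i j ≡ - R i i * H i (σ ⟨$⟩ʳ j)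
    row-eigen i j = begin
      H i j                           ≡⟨ action i j ⟩
      R i i * H i (σ ⟨$⟩ʳ j) * ε j    ≡⟨ cong (R i i * H i (σ ⟨$⟩ʳ j) *_) (ε≡-1 j) ⟩
      R i i * H i (σ ⟨$⟩ʳ j) * - + 1  ≡⟨ solve 2 (λ r h → r :* h :* (:- con (+ 1)) := (:- r) :* h) refl
                                           (R i i) (H i (σ ⟨$⟩ʳ j)) ⟩
      - R i i * H i (σ ⟨$⟩ʳ j)        ∎

open SignedPermutationAction

Fin4-cases : {P : Fin 4 → Set} → P 0F → P 1F → P 2F → P 3F → ∀ c → P c
Fin4-cases p₀ p₁ p₂ p₃ 0F = p₀
Fin4-cases p₀ p₁ p₂ p₃ 1F = p₁
Fin4-cases p₀ p₁ p₂ p₃ 2F = p₂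
Fin4-cases p₀ p₁ p₂ p₃ 3F = p₃

⟦_⟧ : Sgn → ℤ
⟦ s ⟧ = sgn s (+ 1)

sgn-sign : ∀ s {z} → IsSign z → IsSign (sgn s z)
sgn-sign ⊕ z± = z±
sgn-sign ⊖ z± = IsSign-neg z±

someBlock : ∀ k {{_ : NonZero k}} → Fin (4 ℕ.* (2 ℕ.* k))
someBlock (suc k) = zero

module Kimura (k : ℕ) {{_ : NonZero k}} (a b c d : Elt01 k) where
  open import Data.Integer using (_+_; _*_)

  topRight-1·2≡-3 : ∀ bc → ⟦ topRight 1F bc ⟧ * ⟦ topRight 2F bc ⟧ ≡ - ⟦ topRight 3F bc ⟧
  topRight-1·2≡-3 = Fin4-cases refl refl refl refl

  topRight-1·3≡-2 : ∀ bc → ⟦ topRight 1F bc ⟧ * ⟦ topRight 3F bc ⟧ ≡ - ⟦ topRight 2F bc ⟧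
  topRight-1·3≡-2 = Fin4-cases refl refl refl refl

  topRight-2·3≡-1 : ∀ bc → ⟦ topRight 2F bc ⟧ * ⟦ topRight 3F bc ⟧ ≡ - ⟦ topRight 1F bc ⟧
  topRight-2·3≡-1 = Fin4-cases refl refl refl refl

  topRight-1·2·3≡-0 : ∀ bc →
    ⟦ topRight 1F bc ⟧ * ⟦ topRight 2F bc ⟧ * ⟦ topRight 3F bc ⟧ ≡ - ⟦ topRight 0F bc ⟧
  topRight-1·2·3≡-0 = Fin4-cases refl refl refl refl

  topLeft-bottomLeft-overlap≢0 : ∀ r br → sumFin 4 (λ c → ⟦ topLeft r c ⟧ * ⟦ bottomLeft br c ⟧) ≢ + 0
  topLeft-bottomLeft-overlap≢0 = Fin4-cases
    (Fin4-cases (λ ()) (λ ()) (λ ()) (λ ())) (Fin4-cases (λ ()) (λ ()) (λ ()) (λ ()))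
    (Fin4-cases (λ ()) (λ ()) (λ ()) (λ ())) (Fin4-cases (λ ()) (λ ()) (λ ()) (λ ()))

  H : Mat (ord k)
  H = kimura k a b c d

  kimura-row₀ : ∀ j → H 0F j ≡ + 1
  kimura-row₀ j with splitAt 4 j
  ... | inj₁ _ = refl
  ... | inj₂ _ = refl

  top : Fin 4 → Fin (ord k)
  top r = r ↑ˡ 4 ℕ.* (2 ℕ.* k)

  blk : Fin (4 ℕ.* (2 ℕ.* k)) → Fin (ord k)
  blk p = 4 ↑ʳ p

  blockIndex : Fin (4 ℕ.* (2 ℕ.* k)) → Fin 4
  blockIndex p = proj₁ (remQuot {4} (2 ℕ.* k) p)

  kimura-sign : ∀ i j → IsSign (H i j)
  kimura-sign i j with splitAt 4 i | splitAt 4 j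
  ... | inj₁ r | inj₁ s = sgn-sign (topLeft r s) (inj₁ refl)
  ... | inj₁ r | inj₂ q = sgn-sign (topRight r (blockIndex q)) (inj₁ refl)
  ... | inj₂ p | inj₁ s = sgn-sign (bottomLeft (blockIndex p) s) (inj₁ refl)
  ... | inj₂ p | inj₂ q = sgn-sign (proj₁ (blockOf (blockIndex p) (blockIndex q)))
    (pm-sign k (pick (proj₂ (blockOf (blockIndex p) (blockIndex q))) a b c d) (offset p) (offset q))
    where
    offset : Fin (4 ℕ.* (2 ℕ.* k)) → Fin (2 ℕ.* k)
    offset p = proj₂ (remQuot {4} (2 ℕ.* k) p)

  top≢blk : ∀ r p → top r ≢ blk p
  top≢blk 0F p ()
  top≢blk 1F p ()
  top≢blk 2F p ()
  top≢blk 3F p ()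

  top-blk-overlap≢0 : ∀ r p → sumFin 4 (λ c → H (top r) (top c) * H (blk p) (top c)) ≢ + 0
  top-blk-overlap≢0 0F p = topLeft-bottomLeft-overlap≢0 0F (blockIndex p)
  top-blk-overlap≢0 1F p = topLeft-bottomLeft-overlap≢0 1F (blockIndex p)
  top-blk-overlap≢0 2F p = topLeft-bottomLeft-overlap≢0 2F (blockIndex p)
  top-blk-overlap≢0 3F p = topLeft-bottomLeft-overlap≢0 3F (blockIndex p)

  Twisted : Fin 4 → (Fin (ord k) → ℤ) → Set
  Twisted r P = (∀ c → P (top c) ≡ H (top r) (top c)) × (∀ q → P (blk q) ≡ - H (top r) (blk q))

  twisted-product-sum≢0 : IsHadamard H → ∀ r {P} → Twisted r P →
    ∀ p → sumFin (ord k) (λ j → P j * H (blk p) j) ≢ + 0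
  twisted-product-sum≢0 had r {P} (onTop , onBlocks) p ΣPHₚ≡0 =
    top-blk-overlap≢0 r p (ℤP.*-cancelˡ-≡ (+ 2) _ (+ 0) 2·overlap≡0)
    where
    f g : Fin (ord k) → ℤ
    f j = P j * H (blk p) j
    g j = H (top r) j * H (blk p) j
    f≡-g : ∀ q → f (blk q) ≡ - g (blk q)
    f≡-g q = trans (cong (_* H (blk p) (blk q)) (onBlocks q))
      (sym (ℤP.neg-distribˡ-* (H (top r) (blk q)) (H (blk p) (blk q))))
    2·overlap≡0 : + 2 * sumFin 4 (λ c → g (top c)) ≡ + 0
    2·overlap≡0 = begin
      + 2 * sumFin 4 (λ c → g (top c))
        ≡⟨ sumFin-twist 4 (4 ℕ.* (2 ℕ.* k)) f g (λ c → cong (_* H (blk p) (top c)) (onTop c)) f≡-g ⟨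
      sumFin (ord k) f + sumFin (ord k) g
        ≡⟨ cong₂ _+_ ΣPHₚ≡0 (hadamard-rows-orthogonal {H = H} had (top≢blk r p)) ⟩
      + 0 ∎

  kimura-eigenvalues≡1 : IsHadamard H → (σ : Permutation′ (ord k)) (γ : Fin (ord k) → ℤ) →
    (∀ i → Eigen σ (γ i) (H i)) → ∀ i → γ i ≡ + 1
  kimura-eigenvalues≡1 had σ γ rows = γ≡1
    where
    twisted : ∀ r γP {P} → Eigen σ γP P → Twisted r P → ∀ p → γP * γ (blk p) ≡ + 1
    twisted r γP {P} eP tw p =
      eigen-sum≢0⇒≡1 (eigen-* eP (rows (blk p))) (twisted-product-sum≢0 had r {P} tw p)

    γ₁γ₂γ₃γₚ≡1 : ∀ p → γ 1F * γ 2F * γ 3F * γ (blk p) ≡ + 1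
    γ₁γ₂γ₃γₚ≡1 = twisted 0F (γ 1F * γ 2F * γ 3F) (eigen-* (eigen-* (rows 1F) (rows 2F)) (rows 3F))
      (Fin4-cases refl refl refl refl , topRight-1·2·3≡-0 ∘ blockIndex)

    γ₁γ₂γ₃ : γ 1F ≡ + 1 × γ 2F ≡ + 1 × γ 3F ≡ + 1
    γ₁γ₂γ₃ = klein-signs
      (twisted 3F (γ 1F * γ 2F) (eigen-* (rows 1F) (rows 2F))
        (Fin4-cases refl refl refl refl , topRight-1·2≡-3 ∘ blockIndex) p₀)
      (twisted 2F (γ 1F * γ 3F) (eigen-* (rows 1F) (rows 3F))
        (Fin4-cases refl refl refl refl , topRight-1·3≡-2 ∘ blockIndex) p₀)
      (twisted 1F (γ 2F * γ 3F) (eigen-* (rows 2F) (rows 3F))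
        (Fin4-cases refl refl refl refl , topRight-2·3≡-1 ∘ blockIndex) p₀)
      (γ₁γ₂γ₃γₚ≡1 p₀)
      where p₀ = someBlock k

    γ≡1 : ∀ i → γ i ≡ + 1
    γ≡1 0F = begin
      γ 0F                       ≡⟨ ℤP.*-identityʳ (γ 0F) ⟨
      γ 0F * + 1                 ≡⟨ cong (γ 0F *_) (kimura-row₀ (σ ⟨$⟩ʳ 0F)) ⟨
      γ 0F * H 0F (σ ⟨$⟩ʳ 0F)    ≡⟨ Eigen.scaled (rows 0F) 0F ⟨
      + 1                        ∎
    γ≡1 1F = proj₁ γ₁γ₂γ₃
    γ≡1 2F = proj₁ (proj₂ γ₁γ₂γ₃)
    γ≡1 3F = proj₂ (proj₂ γ₁γ₂γ₃)
    γ≡1 (suc (suc (suc (suc p)))) = begin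
      γ (blk p)                         ≡⟨ ℤP.*-identityˡ (γ (blk p)) ⟨
      + 1 * γ (blk p)                   ≡⟨ cong (_* γ (blk p)) γ₁γ₂γ₃≡1 ⟨
      γ 1F * γ 2F * γ 3F * γ (blk p)    ≡⟨ γ₁γ₂γ₃γₚ≡1 p ⟩
      + 1                               ∎
      where
      γ₁γ₂γ₃≡1 : γ 1F * γ 2F * γ 3F ≡ + 1
      γ₁γ₂γ₃≡1 = cong₂ _*_ (cong₂ _*_ (proj₁ γ₁γ₂γ₃) (proj₁ (proj₂ γ₁γ₂γ₃))) (proj₂ (proj₂ γ₁γ₂γ₃))

open import Data.Nat using (_≤_; _+_; _*_)

proposition3p10 : (k : ℕ) → {{_ : NonZero k}} → Σ ℕ (λ m → k ≡ 1 + 2 * m) → 3 ≤ k →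
    (a b c d : Elt01 k) → IsHadamard (kimura k a b c d) →
    (R S : Mat (ord k)) → InAut (kimura k a b c d) R S →
    IsDiagonal R → R zero zero ≡ - (+ 1) →
    (R ≋ negM (identity (ord k))) × (S ≋ negM (identity (ord k)))
proposition3p10 k _ _ a b c d had R S (_ , (σ , ε , _ , S≡) , RHSᵀ≋H) diag R₀₀≡-1 =
  diagonal-≋-negI diag R≡-1 , signedPerm-≋-negI {σ = σ} S≡ σ≡id (proj₁ ε≡-1×rows)
  where
  open Kimura k a b c d
  ε≡-1×rows : (∀ j → ε j ≡ - (+ 1)) × (∀ i → Eigen σ (- R i i) (H i))
  ε≡-1×rows = diagonal-aut-eigen {σ = σ} {ε} diag S≡ RHSᵀ≋H zero kimura-row₀ R₀₀≡-1
  -R≡1 : ∀ i → - R i i ≡ + 1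
  -R≡1 = kimura-eigenvalues≡1 had σ (λ i → - R i i) (proj₂ ε≡-1×rows)
  R≡-1 : ∀ i → R i i ≡ - (+ 1)
  R≡-1 i = trans (sym (ℤP.neg-involutive (R i i))) (cong -_ (-R≡1 i))
  σ≡id : ∀ j → σ ⟨$⟩ʳ j ≡ j
  σ≡id j = sym (hadamard-equal-columns {H = H} had kimura-sign λ t →
    eigen-1⇒invariant (proj₂ ε≡-1×rows t) (-R≡1 t) j)
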